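{- Let $m\geq2$ be an integer and suppose statement $A(m)$ holds. Then for all reals $\varepsilon>0$ and $\lambda>\frac2m$ there is $P$ such that $f_\lambda(p)<(m+1+\varepsilon)p$ for all $p\in D_\lambda$ with $p>P$.
   Context: For an integer $m\geq2$, statement $A(m)$ is: for every $\delta>0$ there is $N(\delta,m)>0$ such that every integer $N\geq N(\delta,m)$ with $N\equiv m\pmod 2$ can be written as a sum of primes $N=q_1+\cdots+q_m$ with $\left|\frac Nm-q_i\right|<\delta N$ for $i=1,\ldots,m$. For a prime $p$ and real $\lambda>0$, $I_\lambda(p)=[p,p+\lambda p]$; $D_\lambda$ is the set of primes $p$ such that $I_\lambda(p)$ contains at least two primes; for $p\in D_\lambda$, $f_\lambda(p)$ is the largest integer that is not a finite sum of primes from $I_\lambda(p)$ (the Frobenius number of the numerical semigroup generated by these primes).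
   Formalization: The parameter ε ranges over the positive rationals rather than the positive reals, and δ in statement $A(m)$ is likewise taken over the positive rationals. -}

module Defs where

open import Data.Nat as ℕ using (ℕ; zero; suc; _≤_; _<_; _%_)
open import Data.Nat.Primality using (Prime)
open import Data.Integer as ℤ using (ℤ; +_)
open import Data.Rational as ℚ using (ℚ; _/_; 0ℚ)
open import Data.Fin using (Fin) renaming (zero to fzero; suc to fsuc)
open import Data.List using (List)
open import Data.Nat.ListAction using (sum)
open import Data.List.Relation.Unary.All using (All)
open import Data.Product using (Σ; ∃; ∃-syntax; _×_)
open import Data.Sum using (_⊎_)
open import Relation.Nullary using (¬_)
open import Relation.Binary.PropositionalEquality using (_≡_; _≢_)

ℕ→ℚ : ℕ → ℚ
ℕ→ℚ n = + n / 1

-- n / d as a rational; the value for d = 0 is an irrelevant convention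
-- (only used with d ≥ 2)
_ℕ/_ : ℕ → ℕ → ℚ
n ℕ/ zero = 0ℚ
n ℕ/ suc d = + n / suc d

ΣFin : (m : ℕ) → (Fin m → ℕ) → ℕ
ΣFin zero q = 0
ΣFin (suc m) q = q fzero ℕ.+ ΣFin m (λ i → q (fsuc i))

A : ℕ → Set
A m = (δ : ℚ) → 0ℚ ℚ.< δ →
  Σ ℕ λ N₀ → (0 < N₀) ×
    ((N : ℕ) → N₀ ≤ N → N % 2 ≡ m % 2 →
      Σ (Fin m → ℕ) λ q →
        ((i : Fin m) → Prime (q i)) ×
        (ΣFin m q ≡ N) ×
        ((i : Fin m) → ℚ.∣ (N ℕ/ m) ℚ.- ℕ→ℚ (q i) ∣ ℚ.< δ ℚ.* ℕ→ℚ N))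

-- Real numbers as Dedekind cuts: L q means q < x, U q means x < q.
record ℝ : Set₁ where
  field
    L U        : ℚ → Set
    L-inhabited : ∃[ q ] L q
    U-inhabited : ∃[ q ] U q
    L-rounded  : (q : ℚ) → (L q → ∃[ r ] (q ℚ.< r × L r)) × (∃[ r ] (q ℚ.< r × L r) → L q)
    U-rounded  : (q : ℚ) → (U q → ∃[ r ] (r ℚ.< q × U r)) × (∃[ r ] (r ℚ.< q × U r) → U q)
    disjoint   : (q : ℚ) → ¬ (L q × U q)
    located    : (q r : ℚ) → q ℚ.< r → L q ⊎ U r

open ℝ public

_<ℝ_ : ℚ → ℝ → Set
q <ℝ x = L x q

_≤ℝ_ : ℚ → ℝ → Set
q ≤ℝ x = ¬ U x q

-- n ∈ I_λ(p) = [p, p + λ p]   (for p > 0: n ≤ p + λ p  ⇔  (n - p)/p ≤ λ)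
InI : ℝ → ℕ → ℕ → Set
InI λ' p n = (p ≤ n) × (((n ℕ.∸ p) ℕ/ p) ≤ℝ λ')

PrimeInI : ℝ → ℕ → ℕ → Set
PrimeInI λ' p q = Prime q × InI λ' p q

D : ℝ → ℕ → Set
D λ' p = Prime p × Σ ℕ λ q₁ → Σ ℕ λ q₂ →
  q₁ ≢ q₂ × PrimeInI λ' p q₁ × PrimeInI λ' p q₂

Representable : ℝ → ℕ → ℤ → Set
Representable λ' p n = Σ (List ℕ) λ qs → All (PrimeInI λ' p) qs × (+ (sum qs) ≡ n)

IsFrobenius : ℝ → ℕ → ℤ → Set
IsFrobenius λ' p f = ¬ Representable λ' p f ×
  ((n : ℤ) → f ℤ.< n → Representable λ' p n)

module Submission where

-- Pick a fraction a/b with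
-- 2/m < a/b < λ and a unit fraction 1/s ≤ ε, and put T = 4b + s and
-- δ = 1/(m(1 + Tm)).  Let N₀ be the threshold given by A(m) for δ.  For every
-- prime p > N₀ + 2 we show that every n ≥ (m + 1 + 1/T)p is a sum of primes of
-- I_λ(p); hence f_λ(p) < (m + 1 + 1/T)p ≤ (m + 1 + ε)p.
--   * Covering lemma (combinatorial): a set closed under adding the odd number
--     p that contains every N ≡ m (mod 2) of the window [(m + 1/T)p, (m + 2 + 1/T)p)
--     contains every n ≥ (m + 1 + 1/T)p.
--   * Window lemma: for N in the window, the m primes given by A(m) lie within
--     δN of N/m, and the inequalities of WindowArithmetic show that they all
--     lie in I_λ(p) = [p, p + λp], so N is representable.
--   * Rational bridges turn the rational data (δ-closeness, λ > 2/m, ε > 0)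
--     into inequalities between naturals, and turn the final natural-number
--     bound back into the rational conclusion.
-- The module FrobeniusEstimate combines these for fixed a, b, s; the theorem
-- only chooses them.

open import Defs
open import Data.Nat as ℕ using (ℕ; zero; suc; _+_; _*_; _∸_; _≤_; _<_; _%_; ∣_-_∣; s≤s; z≤n)
import Data.Nat.Properties as ℕP
open import Data.Nat.DivMod using (%-distribˡ-+; m%n<n)
open import Data.Nat.Divisibility using (m%n≡0⇒n∣m)
open import Data.Nat.Induction using (<-rec)
open import Data.Nat.Primality using (Prime; prime⇒irreducible)
open import Data.Nat.Solver using (module +-*-Solver)
open import Data.Integer as ℤ using (ℤ; +_; -[1+_]; _⊖_)
import Data.Integer.Properties as ℤP
import Data.Integer.Solver as ℤSolver
open import Data.Rational as ℚ using (ℚ; 0ℚ; mkℚ; toℚᵘ; _/_)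
import Data.Rational.Properties as ℚP
open import Data.Rational.Unnormalised as ℚᵘ using (mkℚᵘ; *≡*; *≤*; *<*)
import Data.Rational.Unnormalised.Properties as ℚᵘP
open import Data.Fin using (Fin) renaming (zero to fzero; suc to fsuc)
open import Data.List using ([]; _∷_)
open import Data.List.Relation.Unary.All using ([]; _∷_)
open import Data.Product using (Σ; _×_; _,_; proj₁; proj₂)
open import Data.Sum using (inj₁; inj₂)
open import Data.Empty using (⊥-elim)
open import Function using (_∘_)
open import Relation.Nullary using (¬_; yes; no)
open import Relation.Binary.PropositionalEquality

prime>2⇒odd : ∀ {p} → Prime p → 2 < p → p % 2 ≡ 1
prime>2⇒odd {p} p-prime 2<p with p % 2 in p%2 | m%n<n p 2
... | 0 | _ with prime⇒irreducible p-prime (m%n≡0⇒n∣m p 2 p%2)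
...   | inj₁ ()
...   | inj₂ refl = ⊥-elim (ℕP.<-irrefl refl 2<p)
prime>2⇒odd _ _ | 1 | _ = refl
prime>2⇒odd _ _ | suc (suc _) | s≤s (s≤s ())

parity-shift : ∀ p n m → p % 2 ≡ 1 → (p + n) % 2 ≢ m % 2 → n % 2 ≡ m % 2
parity-shift p n m p-odd differ = bits (n % 2) (m % 2) (m%n<n n 2) (m%n<n m 2) flipped
  where
  flipped : (1 + n % 2) % 2 ≢ m % 2
  flipped eq = differ (trans (%-distribˡ-+ p n 2) (trans (cong (λ r → (r + n % 2) % 2) p-odd) eq))
  bits : ∀ u v → u < 2 → v < 2 → (1 + u) % 2 ≢ v → u ≡ v
  bits 0 0 _ _ _ = refl
  bits 0 1 _ _ ne = ⊥-elim (ne refl)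
  bits 1 0 _ _ ne = ⊥-elim (ne refl)
  bits 1 1 _ _ _ = refl
  bits (suc (suc _)) _ (s≤s (s≤s ())) _ _
  bits _ (suc (suc _)) _ (s≤s (s≤s ())) _

-- Thresholds relative to p at resolution 1/T: "n ≥ (j + 1/T)·p" means
-- (1 + T·j)·p ≤ T·n.
module Threshold (p T : ℕ) where
  open ℕP.≤-Reasoning

  Above : ℕ → ℕ → Set
  Above j n = (1 + T * j) * p ≤ T * n

  above⇒p≤ : ∀ j n → Above (suc j) n → p ≤ n
  above⇒p≤ j n above = ℕP.*-cancelˡ-≤ (suc T) (begin
    suc T * p           ≤⟨ ℕP.*-monoˡ-≤ p (s≤s (ℕP.m≤m*n T (suc j))) ⟩
    (1 + T * suc j) * p ≤⟨ above ⟩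
    T * n               ≤⟨ ℕP.m≤n+m (T * n) n ⟩
    suc T * n           ∎)

  above-shift : ∀ j n → Above (suc j) (p + n) → Above j n
  above-shift j n above = ℕP.+-cancelʳ-≤ (T * p) _ _ (begin
    (1 + T * j) * p + T * p ≡⟨ solve 3 (λ T j p → (con 1 :+ T :* j) :* p :+ T :* p := (con 1 :+ T :* (con 1 :+ j)) :* p) refl T j p ⟩
    (1 + T * suc j) * p     ≤⟨ above ⟩
    T * (p + n)             ≡⟨ solve 3 (λ T p n → T :* (p :+ n) := T :* n :+ T :* p) refl T p n ⟩
    T * n + T * p           ∎)
    where open +-*-Solver

  above-weaken : ∀ j n → Above (suc j) n → Above j n
  above-weaken j n = ℕP.≤-trans (ℕP.*-monoˡ-≤ p (s≤s (ℕP.*-monoʳ-≤ T (ℕP.n≤1+n j))))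

-- Let p be odd and let S be a set of naturals closed under
-- adding p which contains every N ≡ m (mod 2) in the window
-- (m + 1/T)·p ≤ N < (m + 2 + 1/T)·p.  Then S contains every n ≥ (m + 1 + 1/T)·p:
-- subtract p until n lies in [(m + 1 + 1/T)p, (m + 2 + 1/T)p), and there use
-- either n itself or, if its parity is wrong, n - p.
module Covering (p T m : ℕ) (p-odd : p % 2 ≡ 1) (S : ℕ → Set)
  (S-step : ∀ n → S n → S (p + n))
  (S-window : ∀ N → N % 2 ≡ m % 2 → (1 + T * m) * p ≤ T * N → T * N < (1 + T * suc (suc m)) * p → S N)
  where
  open Threshold p T

  covered : ∀ n → Above (suc m) n → S n
  covered = <-rec (λ n → Above (suc m) n → S n) reduce
    where
    -- p is odd, hence positive, so n - p < n and the recursion terminates.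
    p>0 : 0 < p
    p>0 = ℕP.n≢0⇒n>0 (λ p≡0 → 0≢1 (trans (cong (_% 2) (sym p≡0)) p-odd))
      where
      0≢1 : 0 ≢ 1
      0≢1 ()
    reduce : ∀ n → (∀ {n'} → n' < n → Above (suc m) n' → S n') → Above (suc m) n → S n
    reduce n smaller above with ℕP.m≤n⇒∃[o]m+o≡n (above⇒p≤ m n above)
    ... | n' , refl with (1 + T * suc (suc m)) * p ℕP.≤? T * (p + n') | (p + n') % 2 ℕP.≟ m % 2
    ... | yes far | _ = S-step n' (smaller (ℕP.m<n+m n' p>0) (above-shift (suc m) n' far))
    ... | no near | yes same = S-window (p + n') same (above-weaken m (p + n') above) (ℕP.≰⇒> near)
    ... | no near | no other = S-step n' (S-window n' (parity-shift p n' m p-odd other)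
            (above-shift m n' above)
            (ℕP.≤-<-trans (ℕP.*-monoʳ-≤ T (ℕP.m≤n+m n' p)) (ℕP.≰⇒> near)))

module WindowArithmetic where
  open ℕP.≤-Reasoning
  open +-*-Solver

  -- Write E = m(1 + Tm).  A natural q with |N - qm|·E < N·m (i.e. |N/m - q| < N/E)
  -- satisfies T·N < q(1 + Tm) ...
  closeness⇒lower : ∀ N q m1 T → let m = suc m1 in
    ∣ N - q * m ∣ * (m * (1 + T * m)) < N * m → T * N < q * (1 + T * m)
  closeness⇒lower N q m1 T close = ℕP.*-cancelˡ-< (m * m) _ _ (ℕP.+-cancelˡ-< (N * m) _ _ (begin-strict
    N * m + m * m * (T * N)       ≡⟨ solve 3 (λ N m T → N :* m :+ m :* m :* (T :* N) := N :* (m :* (con 1 :+ T :* m))) refl N m T ⟩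
    N * E                         ≤⟨ ℕP.*-monoˡ-≤ E (ℕP.m≤n+∣m-n∣ N (q * m)) ⟩
    (q * m + ∣ N - q * m ∣) * E   ≡⟨ ℕP.*-distribʳ-+ E (q * m) _ ⟩
    q * m * E + ∣ N - q * m ∣ * E <⟨ ℕP.+-monoʳ-< (q * m * E) close ⟩
    q * m * E + N * m             ≡⟨ solve 4 (λ N q m T → q :* m :* (m :* (con 1 :+ T :* m)) :+ N :* m := N :* m :+ m :* m :* (q :* (con 1 :+ T :* m))) refl N q m T ⟩
    N * m + m * m * (q * (1 + T * m)) ∎))
    where
    m = suc m1
    E = m * (1 + T * m)

  closeness⇒upper : ∀ N q m1 T → let m = suc m1 in
    ∣ N - q * m ∣ * (m * (1 + T * m)) < N * m → q * m * (1 + T * m) < N * (2 + T * m)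
  closeness⇒upper N q m1 T close = ℕP.*-cancelˡ-< m _ _ (begin-strict
    m * (q * m * (1 + T * m))     ≡⟨ solve 3 (λ q m T → m :* (q :* m :* (con 1 :+ T :* m)) := q :* m :* (m :* (con 1 :+ T :* m))) refl q m T ⟩
    q * m * E                     ≤⟨ ℕP.*-monoˡ-≤ E (ℕP.m≤n+∣n-m∣ (q * m) N) ⟩
    (N + ∣ N - q * m ∣) * E       ≡⟨ ℕP.*-distribʳ-+ E N _ ⟩
    N * E + ∣ N - q * m ∣ * E     <⟨ ℕP.+-monoʳ-< (N * E) close ⟩
    N * E + N * m                 ≡⟨ solve 3 (λ N m T → N :* (m :* (con 1 :+ T :* m)) :+ N :* m := m :* (N :* (con 2 :+ T :* m))) refl N m T ⟩
    m * (N * (2 + T * m))         ∎)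
    where
    m = suc m1
    E = m * (1 + T * m)

  lower⇒above : ∀ N q m T p → (1 + T * m) * p ≤ T * N → T * N < q * (1 + T * m) → p < q
  lower⇒above N q m T p N≥ TN< = ℕP.*-cancelˡ-< (1 + T * m) p q
    (ℕP.≤-<-trans N≥ (subst (T * N <_) (ℕP.*-comm q (1 + T * m)) TN<))

  -- The numerical core of the upper estimate: for T = 4b + t the top of the
  -- window, (m + 2 + 1/T)p, times the loss factor (2 + Tm)/(m(1 + Tm)) of the
  -- upper bound stays below (1 + (2b + 1)/(bm))p.  Cleared of denominators:
  --   b(2 + Tm)(1 + T(2 + m)) ≤ (bm + 1 + 2b)·T(1 + Tm),
  -- the difference being T·m1·(2b + t) + tT + 2b + t.
  windowConstant : ∀ b t m1 → let T = 4 * b + t; m = suc m1 in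
    b * (2 + T * m) * (1 + T * (2 + m)) ≤ (b * m + (1 + 2 * b)) * (T * (1 + T * m))
  windowConstant b t m1 = ℕP.≤-trans (ℕP.m≤m+n _ (T * m1 * (2 * b + t) + t * T + 2 * b + t))
    (ℕP.≤-reflexive (solve 3 (λ b t m1 →
        b :* (con 2 :+ (con 4 :* b :+ t) :* (con 1 :+ m1)) :* (con 1 :+ (con 4 :* b :+ t) :* (con 2 :+ (con 1 :+ m1)))
          :+ ((con 4 :* b :+ t) :* m1 :* (con 2 :* b :+ t) :+ t :* (con 4 :* b :+ t) :+ con 2 :* b :+ t)
        := (b :* (con 1 :+ m1) :+ (con 1 :+ con 2 :* b)) :* ((con 4 :* b :+ t) :* (con 1 :+ (con 4 :* b :+ t) :* (con 1 :+ m1))))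
      refl b t m1))
    where T = 4 * b + t

  upper⇒within : ∀ N q p a b1 t m1 → let b = suc b1; T = 4 * b + t; m = suc m1 in
    2 * b < a * m → T * N < (1 + T * (2 + m)) * p → q * m * (1 + T * m) < N * (2 + T * m) →
    (q ∸ p) * b ≤ a * p
  upper⇒within N q p a b1 t m1 2b<am N< upper = begin
    (q ∸ p) * b   ≡⟨ ℕP.*-distribʳ-∸ b q p ⟩
    q * b ∸ p * b ≤⟨ ℕP.m≤n+o⇒m∸n≤o (q * b) (p * b) qb≤pb+ap ⟩
    a * p         ∎
    where
    b = suc b1
    T = 4 * b + t
    m = suc m1
    mC = m * (T * (1 + T * m))
    scaled : mC * (q * b) ≤ mC * (p * b + a * p)
    scaled = begin
      mC * (q * b)                              ≡⟨ solve 4 (λ q b m T → m :* (T :* (con 1 :+ T :* m)) :* (q :* b) := b :* T :* (q :* m :* (con 1 :+ T :* m))) refl q b m T ⟩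
      b * T * (q * m * (1 + T * m))             ≤⟨ ℕP.*-monoʳ-≤ (b * T) (ℕP.<⇒≤ upper) ⟩
      b * T * (N * (2 + T * m))                 ≡⟨ solve 4 (λ N b m T → b :* T :* (N :* (con 2 :+ T :* m)) := b :* (con 2 :+ T :* m) :* (T :* N)) refl N b m T ⟩
      b * (2 + T * m) * (T * N)                 ≤⟨ ℕP.*-monoʳ-≤ (b * (2 + T * m)) (ℕP.<⇒≤ N<) ⟩
      b * (2 + T * m) * ((1 + T * (2 + m)) * p) ≡⟨ ℕP.*-assoc (b * (2 + T * m)) (1 + T * (2 + m)) p ⟨
      b * (2 + T * m) * (1 + T * (2 + m)) * p   ≤⟨ ℕP.*-monoˡ-≤ p (windowConstant b t m1) ⟩
      (b * m + (1 + 2 * b)) * (T * (1 + T * m)) * p ≤⟨ ℕP.*-monoˡ-≤ p (ℕP.*-monoˡ-≤ (T * (1 + T * m)) (ℕP.+-monoʳ-≤ (b * m) 2b<am)) ⟩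
      (b * m + a * m) * (T * (1 + T * m)) * p   ≡⟨ solve 5 (λ p a b m T → (b :* m :+ a :* m) :* (T :* (con 1 :+ T :* m)) :* p := m :* (T :* (con 1 :+ T :* m)) :* (p :* b :+ a :* p)) refl p a b m T ⟩
      mC * (p * b + a * p)                      ∎
    qb≤pb+ap : q * b ≤ p * b + a * p
    qb≤pb+ap = ℕP.*-cancelˡ-≤ mC scaled

  belowThreshold : ∀ f M p s1 T .{{_ : ℕ.NonZero T}} → suc s1 ≤ T →
    T * f < (1 + T * M) * p → f * suc s1 < (M * suc s1 + 1) * p
  belowThreshold f M p s1 T s≤T f< = ℕP.*-cancelˡ-< T _ _ (begin-strict
    T * (f * s)          ≡⟨ solve 3 (λ f s T → T :* (f :* s) := s :* (T :* f)) refl f s T ⟩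
    s * (T * f)          <⟨ ℕP.*-monoʳ-< s f< ⟩
    s * ((1 + T * M) * p) ≡⟨ solve 4 (λ M p s T → s :* ((con 1 :+ T :* M) :* p) := (s :+ T :* (M :* s)) :* p) refl M p s T ⟩
    (s + T * (M * s)) * p ≤⟨ ℕP.*-monoˡ-≤ p (ℕP.+-monoˡ-≤ (T * (M * s)) s≤T) ⟩
    (T + T * (M * s)) * p ≡⟨ solve 4 (λ M p s T → (T :+ T :* (M :* s)) :* p := T :* ((M :* s :+ con 1) :* p)) refl M p s T ⟩
    T * ((M * s + 1) * p) ∎)
    where s = suc s1

open WindowArithmetic

-- Rationals are compared by passing to unnormalised
-- fractions (toℚᵘ) and cross-multiplying; the integers that appear are
-- products of naturals, moved back to ℕ by the next two lemmas.
+*+<+*+⇒< : ∀ a b c d → + a ℤ.* + b ℤ.< + c ℤ.* + d → a * b < c * d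
+*+<+*+⇒< a b c d h = ℤP.drop‿+<+ (subst₂ ℤ._<_ (sym (ℤP.pos-* a b)) (sym (ℤP.pos-* c d)) h)

≤⇒+*+≤+*+ : ∀ a b c d → a * b ≤ c * d → + a ℤ.* + b ℤ.≤ + c ℤ.* + d
≤⇒+*+≤+*+ a b c d h = subst₂ ℤ._≤_ (ℤP.pos-* a b) (ℤP.pos-* c d) (ℤ.+≤+ h)

toℚᵘ-ℕ/ : ∀ n d → toℚᵘ (n ℕ/ suc d) ℚᵘ.≃ mkℚᵘ (+ n) d
toℚᵘ-ℕ/ n d = ℚP.toℚᵘ-fromℚᵘ (mkℚᵘ (+ n) d)

∣⊖∣≡∣-∣ : ∀ m n → ℤ.∣ m ⊖ n ∣ ≡ ∣ m - n ∣
∣⊖∣≡∣-∣ m n with ℕP.≤-total m n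
... | inj₁ m≤n = trans (ℤP.∣⊖∣-≤ m≤n) (sym (ℕP.m≤n⇒∣m-n∣≡n∸m m≤n))
... | inj₂ n≤m = trans (ℤP.∣m⊖n∣≡∣n⊖m∣ m n) (trans (ℤP.∣⊖∣-≤ n≤m) (sym (ℕP.m≤n⇒∣n-m∣≡n∸m n≤m)))

toℚᵘ-deviation : ∀ N q m1 → toℚᵘ ((N ℕ/ suc m1) ℚ.- ℕ→ℚ q) ℚᵘ.≃ mkℚᵘ (N ⊖ q * suc m1) m1
toℚᵘ-deviation N q m1 = begin
  toℚᵘ ((N ℕ/ suc m1) ℚ.- ℕ→ℚ q)       ≈⟨ ℚP.toℚᵘ-homo-+ (N ℕ/ suc m1) (ℚ.- ℕ→ℚ q) ⟩
  toℚᵘ (N ℕ/ suc m1) ℚᵘ.+ toℚᵘ (ℚ.- ℕ→ℚ q) ≈⟨ ℚᵘP.+-cong (toℚᵘ-ℕ/ N m1) (ℚᵘP.≃-trans (ℚP.toℚᵘ-homo‿- (ℕ→ℚ q)) (ℚᵘP.-‿cong (toℚᵘ-ℕ/ q 0))) ⟩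
  mkℚᵘ (+ N) m1 ℚᵘ.- mkℚᵘ (+ q) 0       ≈⟨ *≡* cross ⟩
  mkℚᵘ (N ⊖ q * suc m1) m1              ∎
  where
  open ℚᵘP.≃-Reasoning
  open ℤSolver.+-*-Solver
  m = suc m1
  cross : (+ N ℤ.* + 1 ℤ.+ ℤ.- + q ℤ.* + m) ℤ.* + m ≡ (N ⊖ q * m) ℤ.* + (m * 1)
  cross rewrite ℕP.*-identityʳ m | sym (ℤP.m-n≡m⊖n N (q * m)) | ℤP.pos-* q m =
    solve 3 (λ n q m → (n :* con (+ 1) :+ :- q :* m) :* m := (n :- q :* m) :* m) refl (+ N) (+ q) (+ m)

toℚᵘ-fraction-of : ∀ e N → toℚᵘ ((1 ℕ/ suc e) ℚ.* ℕ→ℚ N) ℚᵘ.≃ mkℚᵘ (+ N) e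
toℚᵘ-fraction-of e N = begin
  toℚᵘ ((1 ℕ/ suc e) ℚ.* ℕ→ℚ N)  ≈⟨ ℚP.toℚᵘ-homo-* (1 ℕ/ suc e) (ℕ→ℚ N) ⟩
  toℚᵘ (1 ℕ/ suc e) ℚᵘ.* toℚᵘ (ℕ→ℚ N) ≈⟨ ℚᵘP.*-cong (toℚᵘ-ℕ/ 1 e) (toℚᵘ-ℕ/ N 0) ⟩
  mkℚᵘ (+ 1) e ℚᵘ.* mkℚᵘ (+ N) 0 ≈⟨ *≡* cross ⟩
  mkℚᵘ (+ N) e                   ∎
  where
  open ℚᵘP.≃-Reasoning
  cross : (+ 1 ℤ.* + N) ℤ.* + suc e ≡ + N ℤ.* + (suc e * 1)
  cross = cong₂ ℤ._*_ (ℤP.*-identityˡ (+ N)) (cong +_ (sym (ℕP.*-identityʳ (suc e))))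

closeness : ∀ N q m1 e → ℚ.∣ (N ℕ/ suc m1) ℚ.- ℕ→ℚ q ∣ ℚ.< (1 ℕ/ suc e) ℚ.* ℕ→ℚ N →
  ∣ N - q * suc m1 ∣ * suc e < N * suc m1
closeness N q m1 e h = +*+<+*+⇒< ∣ N - q * suc m1 ∣ (suc e) N (suc m1)
  (subst (λ d → + d ℤ.* + suc e ℤ.< + N ℤ.* + suc m1) (∣⊖∣≡∣-∣ N (q * suc m1)) (ℚᵘP.drop-*<* unnormalised))
  where
  unnormalised : mkℚᵘ (+ ℤ.∣ N ⊖ q * suc m1 ∣) m1 ℚᵘ.< mkℚᵘ (+ N) e
  unnormalised = ℚᵘP.<-respʳ-≃ (toℚᵘ-fraction-of e N)
    (ℚᵘP.<-respˡ-≃ (ℚᵘP.≃-trans (ℚP.toℚᵘ-homo-∣-∣ _) (ℚᵘP.∣-∣-cong (toℚᵘ-deviation N q m1)))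
      (ℚP.toℚᵘ-mono-< h))

≤ℝ-below-cut : (x : ℝ) {y r : ℚ} → y ℚ.≤ r → r <ℝ x → y ≤ℝ x
≤ℝ-below-cut x {y} {r} y≤r r<x x<y with proj₁ (U-rounded x y) x<y
... | s , s<y , x<s = disjoint x s (proj₂ (L-rounded x s) (r , ℚP.<-≤-trans s<y y≤r , r<x) , x<s)

fractionBelow : ∀ n d (x : ℝ) → (n ℕ/ suc d) <ℝ x →
  Σ ℕ λ a → Σ ℕ λ b1 → (n * suc b1 < a * suc d) ×
    (∀ y p1 → y * suc b1 ≤ a * suc p1 → (y ℕ/ suc p1) ≤ℝ x)
fractionBelow n d x n/d<x with proj₁ (L-rounded x (n ℕ/ suc d)) n/d<x
... | r , n/d<r , r<x with ℚᵘP.drop-*<* (ℚᵘP.<-respˡ-≃ (toℚᵘ-ℕ/ n d) (ℚP.toℚᵘ-mono-< n/d<r))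
fractionBelow n d x _ | mkℚ (+ a) b1 _ , _ , r<x | cross =
  a , b1 , +*+<+*+⇒< n (suc b1) a (suc d) cross ,
  λ y p1 le → ≤ℝ-below-cut x
    (ℚP.toℚᵘ-cancel-≤ (ℚᵘP.≤-respˡ-≃ (ℚᵘP.≃-sym (toℚᵘ-ℕ/ y p1)) (*≤* (≤⇒+*+≤+*+ y (suc b1) a (suc p1) le))))
    r<x
fractionBelow n d x _ | mkℚ -[1+ k ] b1 _ , _ , _ | cross
  with subst (ℤ._< _) (sym (ℤP.pos-* n (suc b1))) cross
... | ()

unitFractionBelow : ∀ ε → 0ℚ ℚ.< ε → Σ ℕ λ s1 → (1 ℕ/ suc s1) ℚ.≤ ε
unitFractionBelow (mkℚ (+ suc n) d _) _ =
  d , ℚP.toℚᵘ-cancel-≤ (ℚᵘP.≤-respˡ-≃ (ℚᵘP.≃-sym (toℚᵘ-ℕ/ 1 d))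
        (*≤* (≤⇒+*+≤+*+ 1 (suc d) (suc n) (suc d) (ℕP.*-monoˡ-≤ (suc d) (s≤s (z≤n {n}))))))
unitFractionBelow (mkℚ (+ zero) d _) (ℚ.*<* (ℤ.+<+ ()))
unitFractionBelow (mkℚ -[1+ n ] d _) (ℚ.*<* ())

unitFraction>0 : ∀ e → 0ℚ ℚ.< (1 ℕ/ suc e)
unitFraction>0 e = ℚP.positive⁻¹ (1 ℕ/ suc e) {{ℚP.normalize-pos 1 (suc e)}}

toℚᵘ-[M+1/s]p : ∀ M s1 p → toℚᵘ ((ℕ→ℚ M ℚ.+ (1 ℕ/ suc s1)) ℚ.* ℕ→ℚ p) ℚᵘ.≃ mkℚᵘ (+ ((M * suc s1 + 1) * p)) s1
toℚᵘ-[M+1/s]p M s1 p = begin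
  toℚᵘ ((ℕ→ℚ M ℚ.+ (1 ℕ/ s)) ℚ.* ℕ→ℚ p)
    ≈⟨ ℚP.toℚᵘ-homo-* (ℕ→ℚ M ℚ.+ (1 ℕ/ s)) (ℕ→ℚ p) ⟩
  toℚᵘ (ℕ→ℚ M ℚ.+ (1 ℕ/ s)) ℚᵘ.* toℚᵘ (ℕ→ℚ p)
    ≈⟨ ℚᵘP.*-cong (ℚᵘP.≃-trans (ℚP.toℚᵘ-homo-+ (ℕ→ℚ M) (1 ℕ/ s)) (ℚᵘP.+-cong (toℚᵘ-ℕ/ M 0) (toℚᵘ-ℕ/ 1 s1))) (toℚᵘ-ℕ/ p 0) ⟩
  (mkℚᵘ (+ M) 0 ℚᵘ.+ mkℚᵘ (+ 1) s1) ℚᵘ.* mkℚᵘ (+ p) 0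
    ≈⟨ *≡* cross ⟩
  mkℚᵘ (+ ((M * s + 1) * p)) s1 ∎
  where
  open ℚᵘP.≃-Reasoning
  open ℤSolver.+-*-Solver
  s = suc s1
  embed : + ((M * s + 1) * p) ≡ (+ M ℤ.* + s ℤ.+ + 1) ℤ.* + p
  embed = trans (ℤP.pos-* (M * s + 1) p)
    (cong (ℤ._* + p) (trans (ℤP.pos-+ (M * s) 1) (cong (ℤ._+ + 1) (ℤP.pos-* M s))))
  cross : ((+ M ℤ.* + s ℤ.+ + 1 ℤ.* + 1) ℤ.* + p) ℤ.* + s ≡ + ((M * s + 1) * p) ℤ.* + (1 * s * 1)
  cross = trans
    (solve 3 (λ m s p → ((m :* s :+ con (+ 1) :* con (+ 1)) :* p) :* s := ((m :* s :+ con (+ 1)) :* p) :* s)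
      refl (+ M) (+ s) (+ p))
    (cong₂ ℤ._*_ (sym embed) (cong +_ (sym (trans (ℕP.*-identityʳ (1 * s)) (ℕP.*-identityˡ s)))))

boundWithUnitFraction : ∀ M p s1 ε (f : ℤ) → (1 ℕ/ suc s1) ℚ.≤ ε →
  f ℤ.* + suc s1 ℤ.< + ((M * suc s1 + 1) * p) →
  (f / 1) ℚ.< (ℕ→ℚ M ℚ.+ ε) ℚ.* ℕ→ℚ p
boundWithUnitFraction M p s1 ε f 1/s≤ε fs<[Ms+1]p = ℚP.<-≤-trans f<[M+1/s]p [M+1/s]p≤[M+ε]p
  where
  f<[M+1/s]p : (f / 1) ℚ.< (ℕ→ℚ M ℚ.+ (1 ℕ/ suc s1)) ℚ.* ℕ→ℚ p
  f<[M+1/s]p = ℚP.toℚᵘ-cancel-< (ℚᵘP.<-respʳ-≃ (ℚᵘP.≃-sym (toℚᵘ-[M+1/s]p M s1 p))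
    (ℚᵘP.<-respˡ-≃ (ℚᵘP.≃-sym (ℚP.toℚᵘ-fromℚᵘ (mkℚᵘ f 0)))
      (*<* (subst (f ℤ.* + suc s1 ℤ.<_) (sym (ℤP.*-identityʳ _)) fs<[Ms+1]p))))
  [M+1/s]p≤[M+ε]p : (ℕ→ℚ M ℚ.+ (1 ℕ/ suc s1)) ℚ.* ℕ→ℚ p ℚ.≤ (ℕ→ℚ M ℚ.+ ε) ℚ.* ℕ→ℚ p
  [M+1/s]p≤[M+ε]p = ℚP.*-monoʳ-≤-nonNeg (ℕ→ℚ p) {{ℚP.normalize-nonNeg p 1}} (ℚP.+-monoʳ-≤ (ℕ→ℚ M) 1/s≤ε)

Representableℕ : ℝ → ℕ → ℕ → Set
Representableℕ λ' p n = Representable λ' p (+ n)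

representable-+ : ∀ λ' p {q n} → PrimeInI λ' p q → Representableℕ λ' p n → Representableℕ λ' p (q + n)
representable-+ λ' p {q} q∈I (qs , qs∈I , sum≡n) =
  q ∷ qs , q∈I ∷ qs∈I , cong (λ s → + (q + s)) (ℤP.+-injective sum≡n)

family⇒representable : ∀ λ' p m (q : Fin m → ℕ) → (∀ i → PrimeInI λ' p (q i)) →
  Representableℕ λ' p (ΣFin m q)
family⇒representable λ' p zero q _ = [] , [] , refl
family⇒representable λ' p (suc m) q q∈I =
  representable-+ λ' p (q∈I fzero) (family⇒representable λ' p m (q ∘ fsuc) (q∈I ∘ fsuc))

Decomposition : ℕ → ℚ → ℕ → Set
Decomposition m δ N₀ = (N : ℕ) → N₀ ≤ N → N % 2 ≡ m % 2 →
  Σ (Fin m → ℕ) λ q →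
    ((i : Fin m) → Prime (q i)) ×
    (ΣFin m q ≡ N) ×
    ((i : Fin m) → ℚ.∣ (N ℕ/ m) ℚ.- ℕ→ℚ (q i) ∣ ℚ.< δ ℚ.* ℕ→ℚ N)

module FrobeniusEstimate (m1 : ℕ) (λ' : ℝ) (a b1 s1 : ℕ) (2b<am : 2 * suc b1 < a * suc m1)
  (fraction-test : ∀ y p1 → y * suc b1 ≤ a * suc p1 → (y ℕ/ suc p1) ≤ℝ λ') where

  m b s T : ℕ
  m = suc m1
  b = suc b1
  s = suc s1
  T = 4 * b + s

  -- δ = 1/E with E = m(1 + Tm) = suc E-1.
  E-1 : ℕ
  E-1 = T * m + m1 * (1 + T * m)

  δ : ℚ
  δ = 1 ℕ/ suc E-1

  p∈I : ∀ p1 → Prime (suc p1) → PrimeInI λ' (suc p1) (suc p1)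
  p∈I p1 p-prime = p-prime , ℕP.≤-refl ,
    subst (λ y → (y ℕ/ suc p1) ≤ℝ λ') (sym (ℕP.n∸n≡0 (suc p1))) (fraction-test 0 p1 z≤n)

  closePrime∈I : ∀ p1 N q → Prime q → (1 + T * m) * suc p1 ≤ T * N → T * N < (1 + T * (2 + m)) * suc p1 →
    ℚ.∣ (N ℕ/ m) ℚ.- ℕ→ℚ q ∣ ℚ.< δ ℚ.* ℕ→ℚ N → PrimeInI λ' (suc p1) q
  closePrime∈I p1 N q q-prime N≥ N< close =
    q-prime ,
    ℕP.<⇒≤ (lower⇒above N q m T p N≥ (closeness⇒lower N q m1 T close′)) ,
    fraction-test (q ∸ p) p1 (upper⇒within N q p a b1 s m1 2b<am N< (closeness⇒upper N q m1 T close′))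
    where
    p = suc p1
    close′ = closeness N q m1 E-1 close

  window : ∀ p1 N → (1 + T * m) * suc p1 ≤ T * N → T * N < (1 + T * (2 + m)) * suc p1 →
    ∀ {N₀} → Decomposition m δ N₀ → N₀ ≤ N → N % 2 ≡ m % 2 → Representableℕ λ' (suc p1) N
  window p1 N N≥ N< decompose N₀≤N parity with decompose N N₀≤N parity
  ... | q , primes , sum≡N , close =
    subst (Representableℕ λ' (suc p1)) sum≡N
      (family⇒representable λ' (suc p1) m q (λ i → closePrime∈I p1 N (q i) (primes i) N≥ N< (close i)))

  representableAbove : ∀ {N₀} → Decomposition m δ N₀ → ∀ p1 → Prime (suc p1) → N₀ + 2 < suc p1 →
    ∀ n → Threshold.Above (suc p1) T (suc m) n → Representableℕ λ' (suc p1) n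
  representableAbove {N₀} decompose p1 p-prime P<p = covered
    where
    p = suc p1
    open Threshold p T using (above⇒p≤)
    inWindow : ∀ N → N % 2 ≡ m % 2 → (1 + T * m) * p ≤ T * N → T * N < (1 + T * (2 + m)) * p →
      Representableℕ λ' p N
    inWindow N parity N≥ N< = window p1 N N≥ N< decompose
      (ℕP.≤-trans (ℕP.≤-trans (ℕP.m≤m+n N₀ 2) (ℕP.<⇒≤ P<p)) (above⇒p≤ m1 N N≥)) parity
    p-odd : p % 2 ≡ 1
    p-odd = prime>2⇒odd p-prime (ℕP.≤-<-trans (ℕP.m≤n+m 2 N₀) P<p)
    open Covering p T m p-odd (Representableℕ λ' p) (λ n → representable-+ λ' p (p∈I p1 p-prime)) inWindow
      using (covered)

  nonRepresentableBelow : ∀ {N₀} → Decomposition m δ N₀ → ∀ p1 → Prime (suc p1) → N₀ + 2 < suc p1 →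
    ∀ f → ¬ Representable λ' (suc p1) f → f ℤ.* + s ℤ.< + (((m + 1) * s + 1) * suc p1)
  nonRepresentableBelow decompose p1 p-prime P<p -[1+ k ] _ = ℤ.-<+
  nonRepresentableBelow decompose p1 p-prime P<p (+ f) f∉
    with (1 + T * suc m) * suc p1 ℕP.≤? T * f
  ... | yes above = ⊥-elim (f∉ (representableAbove decompose p1 p-prime P<p f above))
  ... | no below = subst₂ ℤ._<_ (ℤP.pos-* f s) (cong (λ M → + ((M * s + 1) * suc p1)) (ℕP.+-comm 1 m))
    (ℤ.+<+ (belowThreshold f (suc m) (suc p1) s1 T (ℕP.m≤n+m s (4 * b)) (ℕP.≰⇒> below)))

  frobeniusBound : A m → ∀ ε → (1 ℕ/ s) ℚ.≤ ε →
    Σ ℕ λ P → (p : ℕ) → D λ' p → P < p →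
      (f : ℤ) → IsFrobenius λ' p f → (f / 1) ℚ.< (ℕ→ℚ (m + 1) ℚ.+ ε) ℚ.* ℕ→ℚ p
  frobeniusBound hA ε 1/s≤ε with hA δ (unitFraction>0 E-1)
  ... | N₀ , _ , decompose = N₀ + 2 , bound
    where
    bound : (p : ℕ) → D λ' p → N₀ + 2 < p → (f : ℤ) → IsFrobenius λ' p f →
      (f / 1) ℚ.< (ℕ→ℚ (m + 1) ℚ.+ ε) ℚ.* ℕ→ℚ p
    bound (suc p1) (p-prime , _) P<p f (f∉ , _) = boundWithUnitFraction (m + 1) (suc p1) s1 ε f 1/s≤ε
      (nonRepresentableBelow decompose p1 p-prime P<p f f∉)

-- The theorem: choose a/b between 2/m and λ and 1/s ≤ ε, and apply the
-- estimate.  (The argument works for every m ≥ 1; m ≥ 2 only excludes m = 0.)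
proposition2p1 : (m : ℕ) → 2 ≤ m → A m →
    (ε : ℚ) → 0ℚ ℚ.< ε → (λ' : ℝ) → (2 ℕ/ m) <ℝ λ' →
    Σ ℕ λ P → (p : ℕ) → D λ' p → P < p →
      (f : ℤ) → IsFrobenius λ' p f →
        (f / 1) ℚ.< (ℕ→ℚ (m ℕ.+ 1) ℚ.+ ε) ℚ.* ℕ→ℚ p
proposition2p1 zero ()
proposition2p1 (suc m1) _ hA ε ε>0 λ' 2/m<λ
  with fractionBelow 2 m1 λ' 2/m<λ | unitFractionBelow ε ε>0
... | a , b1 , 2b<am , fraction-test | s1 , 1/s≤ε =
  FrobeniusEstimate.frobeniusBound m1 λ' a b1 s1 2b<am fraction-test hA ε 1/s≤ε
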